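{- Let $\xi$ be a finite collection of connected graphs each containing a cycle, and let $r\ge0$ be the number of cycles (polygons $C_\ell$, of pairwise distinct lengths) in $\xi$. Then for all $k\ge1$, $$k\,b_k\le c^{(\xi)}_k\le\frac{19+6r}{5}\,k\,b_k.$$
   Context: Wright's constants: $b_1=\frac5{24}$, $2(k+1)b_{k+1}=3k(k+1)b_k+3\sum_{t=1}^{k-1}t(k-t)b_tb_{k-t}$; $c_1=\frac{19}{24}$, $2(3k+2)c_{k+1}=8(k+1)b_{k+1}+3kb_k+(3k+2)(3k-1)c_k+6\sum_{t=1}^{k-1}t(3k-3t-1)b_tc_{k-t}$ ($k\ge1$). The numbers $c^{(\xi)}_k$ are defined by $c^{(\xi)}_1=\frac{19+6r}{24}$ and $c^{(\xi)}_{k+1}=c_{k+1}+\frac32 r k b_k$ for $k\ge1$. -}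

module Defs where

open import Data.Nat as ℕ using (ℕ; zero; suc; _∸_; _≡ᵇ_)
open import Data.Integer using (+_)
open import Data.Rational using (ℚ; _/_; _+_; _*_; 0ℚ)
open import Data.Product using (_×_; _,_; proj₁; proj₂)
open import Data.Bool using (if_then_else_)

ℕ→ℚ : ℕ → ℚ
ℕ→ℚ n = + n / 1

Σ : ℕ → (ℕ → ℚ) → ℚ
Σ zero    f = 0ℚ
Σ (suc n) f = Σ n f + f (suc n)

-- bc k = (B , C) where B i = b_i and C i = c_i for 1 ≤ i ≤ k+1
-- (values at other indices are irrelevant junk).
bc : ℕ → (ℕ → ℚ) × (ℕ → ℚ)
bc zero = (λ _ → + 5 / 24) , (λ _ → + 19 / 24)
bc (suc j) = B' , C'
  where
  B : ℕ → ℚ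
  B = proj₁ (bc j)
  C : ℕ → ℚ
  C = proj₂ (bc j)
  -- m plays the role of k (≥ 1) in the recurrences; we compute index m+1
  m : ℕ
  m = suc j
  bnew : ℚ
  bnew = ( ℕ→ℚ (3 ℕ.* m ℕ.* suc m) * B m
         + ℕ→ℚ 3 * Σ (m ∸ 1) (λ t → ℕ→ℚ (t ℕ.* (m ∸ t)) * B t * B (m ∸ t)) )
         * (+ 1 / (2 ℕ.* suc m))
  cnew : ℚ
  cnew = ( ℕ→ℚ (8 ℕ.* suc m) * bnew
         + ℕ→ℚ (3 ℕ.* m) * B m
         + ℕ→ℚ ((2 ℕ.+ 3 ℕ.* m) ℕ.* (3 ℕ.* m ∸ 1)) * C m
         + ℕ→ℚ 6 * Σ (m ∸ 1) (λ t → ℕ→ℚ (t ℕ.* (3 ℕ.* m ∸ 3 ℕ.* t ∸ 1)) * B t * C (m ∸ t)) )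
         * (+ 1 / (2 ℕ.* (2 ℕ.+ 3 ℕ.* m)))
  B' : ℕ → ℚ
  B' i = if i ≡ᵇ suc m then bnew else B i
  C' : ℕ → ℚ
  C' i = if i ≡ᵇ suc m then cnew else C i

b : ℕ → ℚ
b k = proj₁ (bc (k ∸ 1)) k

c : ℕ → ℚ
c k = proj₂ (bc (k ∸ 1)) k

-- c^{(ξ)}_k, which depends on ξ only through r = number of cycles in ξ
cξ : ℕ → ℕ → ℚ
cξ r zero = 0ℚ  -- junk, unused (k ≥ 1)
cξ r (suc zero) = + (19 ℕ.+ 6 ℕ.* r) / 24
cξ r (suc (suc k)) = c (suc (suc k)) + (+ 3 / 2) * ℕ→ℚ r * ℕ→ℚ (suc k) * b (suc k)

{-# OPTIONS --safe #-}
module Submission where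

open import Defs
open import Data.Nat using (ℕ; _≤_)
open import Data.Integer using (+_)
open import Data.Rational using (ℚ; _/_; _*_) renaming (_≤_ to _≤ℚ_)
open import Data.Product using (_×_)

open import Agda.Builtin.FromNat using (Number; fromNat)
open import Algebra.Bundles using (CommutativeMonoid)
import Algebra.Properties.CommutativeSemigroup as CommSemigroupProperties
open import Data.Bool using (true; false)
open import Data.Bool.Properties using (T-≡; ¬-not)
import Data.Integer as ℤ
import Data.Integer.Properties as ℤ
import Data.Nat as ℕ
import Data.Nat.Literals as ℕ
import Data.Nat.Properties as ℕ
open import Data.Nat using (suc; zero; _∸_; _<_; _≡ᵇ_; z≤n; s≤s; NonZero)
open import Data.Nat.Coprimality using (1-coprimeTo) renaming (sym to coprime-sym)
open import Data.Nat.Induction using (<-rec)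
open import Data.Product using (_,_; proj₁; proj₂)
open import Data.Rational using (_+_; _-_; -_; 0ℚ; 1/_; positive; nonNegative) renaming (_<_ to _<ℚ_)
import Data.Rational.Literals as ℚ
open import Data.Rational.Properties
  using ( +-*-commutativeRing; *-1-commutativeMonoid; _≟_
        ; +-comm; +-assoc; +-identityʳ; *-assoc; *-identityʳ; *-zeroʳ; *-distribˡ-+; *-distribʳ-+
        ; *-inverseʳ; /-cong; normalize-coprime; normalize-nonNeg
        ; ≤-refl; ≤-trans; ≤ᵇ⇒≤; +-mono-≤; +-monoʳ-≤; +-monoˡ-≤; +-mono-<-≤
        ; *-monoˡ-≤-nonNeg; *-monoʳ-≤-nonNeg; *-cancelˡ-≤-pos
        ; positive⁻¹; nonNegative⁻¹; nonNeg*nonNeg⇒nonNeg; module ≤-Reasoning )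
open import Data.Sum using (inj₁; inj₂)
open import Data.Unit using (tt)
open import Function using (Equivalence)
open import Level using (0ℓ)
open import Relation.Binary.PropositionalEquality
open import Relation.Nullary.Decidable using (dec⇒maybe)
open import Tactic.RingSolver using (solve-∀)
open import Tactic.RingSolver.Core.AlmostCommutativeRing using (AlmostCommutativeRing; fromCommutativeRing)

-- Both bounds rest on k b_k ≤ c_k ≤ (19/5) k b_k, proved by strong induction on k. In the
-- recurrence for c_{k+1}, bound c_k and every c_{k-t} by the induction hypothesis; pairing t with
-- k - t shows Σ t(3k-3t-1)(k-t) b_t b_{k-t} = ((3k-2)/2) Σ t(k-t) b_t b_{k-t}, so both bounds
-- only involve b_k and the b-convolution, which the recurrence for b_{k+1} ties to (k+1) b_{k+1};
-- what is left are polynomial identities with nonnegative slack. The extra term (3/2) r k b_k of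
-- c^{(ξ)}_{k+1} is absorbed by 3 k b_k ≤ 2 (k+1) b_{k+1}, read off the recurrence for b_{k+1}.

-- With fromNat in scope numeric literals are overloaded (3 * K below is rational); the
-- instance constructor tt, also imported above, discharges their trivial Constraint.
instance
  ℕ-number : Number ℕ
  ℕ-number = ℕ.number
  ℚ-number : Number ℚ
  ℚ-number = ℚ.number

ℚ-ring : AlmostCommutativeRing 0ℓ 0ℓ
ℚ-ring = fromCommutativeRing +-*-commutativeRing (λ x → dec⇒maybe (0ℚ ≟ x))

open CommSemigroupProperties (CommutativeMonoid.commutativeSemigroup *-1-commutativeMonoid)
  using () renaming (x∙yz≈y∙xz to *-leftComm)

*-nonNeg : ∀ {p q} → 0ℚ ≤ℚ p → 0ℚ ≤ℚ q → 0ℚ ≤ℚ p * q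
*-nonNeg {p} {q} 0≤p 0≤q =
  nonNegative⁻¹ (p * q) {{nonNeg*nonNeg⇒nonNeg p {{nonNegative 0≤p}} q {{nonNegative 0≤q}}}}

+-nonNeg : ∀ {p q} → 0ℚ ≤ℚ p → 0ℚ ≤ℚ q → 0ℚ ≤ℚ p + q
+-nonNeg = +-mono-≤

p≤p+q : ∀ {p q} → 0ℚ ≤ℚ q → p ≤ℚ p + q
p≤p+q {p} {q} 0≤q = subst (_≤ℚ p + q) (+-identityʳ p) (+-monoʳ-≤ p 0≤q)

*-monoˡ-≤ : ∀ {r p q} → 0ℚ ≤ℚ r → p ≤ℚ q → r * p ≤ℚ r * q
*-monoˡ-≤ {r} 0≤r = *-monoˡ-≤-nonNeg r {{nonNegative 0≤r}}

ℕ→ℚ-nonNeg : ∀ n → 0ℚ ≤ℚ ℕ→ℚ n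
ℕ→ℚ-nonNeg n = nonNegative⁻¹ (ℕ→ℚ n) {{normalize-nonNeg n 1}}

ℕ→ℚ≡fromℤ : ∀ n → ℕ→ℚ n ≡ ℚ.fromℤ (+ n)
ℕ→ℚ≡fromℤ n = normalize-coprime (coprime-sym (1-coprimeTo n))

ℕ→ℚ-homo-+ : ∀ m n → ℕ→ℚ (m ℕ.+ n) ≡ ℕ→ℚ m + ℕ→ℚ n
ℕ→ℚ-homo-+ m n = sym (begin
  ℕ→ℚ m + ℕ→ℚ n                              ≡⟨ cong₂ _+_ (ℕ→ℚ≡fromℤ m) (ℕ→ℚ≡fromℤ n) ⟩
  (+ m ℤ.* + 1 ℤ.+ + n ℤ.* + 1) / 1          ≡⟨ /-cong (cong₂ ℤ._+_ (ℤ.*-identityʳ (+ m)) (ℤ.*-identityʳ (+ n))) refl ⟩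
  ℕ→ℚ (m ℕ.+ n)                              ∎)
  where open ≡-Reasoning

ℕ→ℚ-homo-* : ∀ m n → ℕ→ℚ (m ℕ.* n) ≡ ℕ→ℚ m * ℕ→ℚ n
ℕ→ℚ-homo-* m n = sym (begin
  ℕ→ℚ m * ℕ→ℚ n                              ≡⟨ cong₂ _*_ (ℕ→ℚ≡fromℤ m) (ℕ→ℚ≡fromℤ n) ⟩
  (+ m ℤ.* + n) / 1                           ≡⟨ /-cong (sym (ℤ.pos-* m n)) refl ⟩
  ℕ→ℚ (m ℕ.* n)                              ∎)
  where open ≡-Reasoning

ℕ→ℚ-suc : ∀ n → ℕ→ℚ (suc n) ≡ 1 + ℕ→ℚ n
ℕ→ℚ-suc = ℕ→ℚ-homo-+ 1

ℕ→ℚ-homo-∸ : ∀ {m n} → n ≤ m → ℕ→ℚ (m ∸ n) ≡ ℕ→ℚ m - ℕ→ℚ n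
ℕ→ℚ-homo-∸ {m} {n} n≤m = begin
  ℕ→ℚ (m ∸ n)                                ≡⟨ x≡x+y-y (ℕ→ℚ (m ∸ n)) (ℕ→ℚ n) ⟩
  ℕ→ℚ (m ∸ n) + ℕ→ℚ n - ℕ→ℚ n               ≡⟨ cong (_- ℕ→ℚ n) (sym (ℕ→ℚ-homo-+ (m ∸ n) n)) ⟩
  ℕ→ℚ (m ∸ n ℕ.+ n) - ℕ→ℚ n                 ≡⟨ cong (λ x → ℕ→ℚ x - ℕ→ℚ n) (ℕ.m∸n+n≡m n≤m) ⟩
  ℕ→ℚ m - ℕ→ℚ n                              ∎
  where
  open ≡-Reasoning
  x≡x+y-y : ∀ x y → x ≡ x + y - y
  x≡x+y-y = solve-∀ ℚ-ring

ℕ→ℚ-mono-≤ : ∀ {m n} → m ≤ n → ℕ→ℚ m ≤ℚ ℕ→ℚ n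
ℕ→ℚ-mono-≤ {m} {n} m≤n = subst (ℕ→ℚ m ≤ℚ_) m+[n-m]≡n (p≤p+q (ℕ→ℚ-nonNeg (n ∸ m)))
  where
  m+[n-m]≡n : ℕ→ℚ m + ℕ→ℚ (n ∸ m) ≡ ℕ→ℚ n
  m+[n-m]≡n = trans (sym (ℕ→ℚ-homo-+ m (n ∸ m))) (cong ℕ→ℚ (ℕ.m+[n∸m]≡n m≤n))

n*[x*1/n]≡x : ∀ n .{{_ : NonZero n}} x → ℕ→ℚ n * (x * (+ 1 / n)) ≡ x
n*[x*1/n]≡x n@(suc _) x = begin
  ℕ→ℚ n * (x * (+ 1 / n))                    ≡⟨ *-leftComm (ℕ→ℚ n) x (+ 1 / n) ⟩
  x * (ℕ→ℚ n * (+ 1 / n))                    ≡⟨ cong₂ (λ a i → x * (a * i)) (ℕ→ℚ≡fromℤ n) (normalize-coprime (1-coprimeTo n)) ⟩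
  x * (ℚ.fromℤ (+ n) * 1/ ℚ.fromℤ (+ n))   ≡⟨ cong (x *_) (*-inverseʳ (ℚ.fromℤ (+ n))) ⟩
  x * 1                                       ≡⟨ *-identityʳ x ⟩
  x                                           ∎
  where open ≡-Reasoning

n/d≡n*[1/d] : ∀ n d-1 → + n / suc d-1 ≡ ℕ→ℚ n * (+ 1 / suc d-1)
n/d≡n*[1/d] n d-1 = sym (begin
  ℕ→ℚ n * (+ 1 / suc d-1)                      ≡⟨ cong₂ _*_ (ℕ→ℚ≡fromℤ n) (normalize-coprime (1-coprimeTo (suc d-1))) ⟩
  (+ n ℤ.* + 1) / (1 ℕ.* suc d-1)              ≡⟨ /-cong (ℤ.*-identityʳ (+ n)) (ℕ.*-identityˡ (suc d-1)) ⟩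
  + n / suc d-1                                ∎)
  where open ≡-Reasoning

Σ-cong : ∀ n {f g : ℕ → ℚ} → (∀ {t} → 1 ≤ t → t ≤ n → f t ≡ g t) → Σ n f ≡ Σ n g
Σ-cong zero    f≡g = refl
Σ-cong (suc n) f≡g = cong₂ _+_ (Σ-cong n λ 1≤t t≤n → f≡g 1≤t (ℕ.m≤n⇒m≤1+n t≤n)) (f≡g (s≤s z≤n) ℕ.≤-refl)

Σ-mono-≤ : ∀ n {f g : ℕ → ℚ} → (∀ {t} → 1 ≤ t → t ≤ n → f t ≤ℚ g t) → Σ n f ≤ℚ Σ n g
Σ-mono-≤ zero    f≤g = ≤-refl
Σ-mono-≤ (suc n) f≤g = +-mono-≤ (Σ-mono-≤ n λ 1≤t t≤n → f≤g 1≤t (ℕ.m≤n⇒m≤1+n t≤n)) (f≤g (s≤s z≤n) ℕ.≤-refl)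

Σ-nonNeg : ∀ n {f : ℕ → ℚ} → (∀ {t} → 1 ≤ t → t ≤ n → 0ℚ ≤ℚ f t) → 0ℚ ≤ℚ Σ n f
Σ-nonNeg zero    0≤f = ≤-refl
Σ-nonNeg (suc n) 0≤f = +-nonNeg (Σ-nonNeg n λ 1≤t t≤n → 0≤f 1≤t (ℕ.m≤n⇒m≤1+n t≤n)) (0≤f (s≤s z≤n) ℕ.≤-refl)

Σ-+ : ∀ n (f g : ℕ → ℚ) → Σ n (λ t → f t + g t) ≡ Σ n f + Σ n g
Σ-+ zero    f g = refl
Σ-+ (suc n) f g = trans (cong (_+ (f (suc n) + g (suc n))) (Σ-+ n f g))
                        (+-interchange (Σ n f) (Σ n g) (f (suc n)) (g (suc n)))
  where
  +-interchange : ∀ a b c d → a + b + (c + d) ≡ a + c + (b + d)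
  +-interchange = solve-∀ ℚ-ring

Σ-*ˡ : ∀ n a (f : ℕ → ℚ) → Σ n (λ t → a * f t) ≡ a * Σ n f
Σ-*ˡ zero    a f = sym (*-zeroʳ a)
Σ-*ˡ (suc n) a f = trans (cong (_+ a * f (suc n)) (Σ-*ˡ n a f)) (sym (*-distribˡ-+ a (Σ n f) (f (suc n))))

Σ-linear : ∀ n a a′ (f g : ℕ → ℚ) → Σ n (λ t → a * f t + a′ * g t) ≡ a * Σ n f + a′ * Σ n g
Σ-linear n a a′ f g = trans (Σ-+ n (λ t → a * f t) (λ t → a′ * g t)) (cong₂ _+_ (Σ-*ˡ n a f) (Σ-*ˡ n a′ g))

Σ-suc : ∀ n (f : ℕ → ℚ) → Σ (suc n) f ≡ f 1 + Σ n (λ t → f (suc t))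
Σ-suc zero    f = +-comm 0ℚ (f 1)
Σ-suc (suc n) f = trans (cong (_+ f (2 ℕ.+ n)) (Σ-suc n f)) (+-assoc (f 1) (Σ n (λ t → f (suc t))) (f (2 ℕ.+ n)))

Σ-reflect : ∀ n (f : ℕ → ℚ) → Σ n f ≡ Σ n (λ t → f (suc n ∸ t))
Σ-reflect zero    f = refl
Σ-reflect (suc n) f = begin
  Σ n f + f (suc n)                           ≡⟨ +-comm (Σ n f) (f (suc n)) ⟩
  f (suc n) + Σ n f                           ≡⟨ cong (_+_ (f (suc n))) (Σ-reflect n f) ⟩
  f (suc n) + Σ n (λ t → f (suc n ∸ t))       ≡⟨ Σ-suc n (λ t → f (2 ℕ.+ n ∸ t)) ⟨
  Σ (suc n) (λ t → f (2 ℕ.+ n ∸ t))           ∎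
  where open ≡-Reasoning

Σ-symmetric-weight : ∀ n (g : ℕ → ℚ) → (∀ {t} → 1 ≤ t → t ≤ n → g (suc n ∸ t) ≡ g t) →
                     2 * Σ n (λ t → ℕ→ℚ (suc n ∸ t) * g t) ≡ ℕ→ℚ (suc n) * Σ n g
Σ-symmetric-weight n g g-sym = begin
  2 * W                                               ≡⟨ 2*x≡x+x W ⟩
  W + W                                               ≡⟨ cong (_+_ W) W≡Σtg ⟩
  W + Σ n (λ t → ℕ→ℚ t * g t)                         ≡⟨ Σ-+ n _ _ ⟨
  Σ n (λ t → ℕ→ℚ (suc n ∸ t) * g t + ℕ→ℚ t * g t)     ≡⟨ Σ-cong n weights-add-up ⟩
  Σ n (λ t → ℕ→ℚ (suc n) * g t)                       ≡⟨ Σ-*ˡ n (ℕ→ℚ (suc n)) g ⟩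
  ℕ→ℚ (suc n) * Σ n g                                 ∎
  where
  open ≡-Reasoning
  W : ℚ
  W = Σ n (λ t → ℕ→ℚ (suc n ∸ t) * g t)

  2*x≡x+x : ∀ x → 2 * x ≡ x + x
  2*x≡x+x = solve-∀ ℚ-ring

  W≡Σtg : W ≡ Σ n (λ t → ℕ→ℚ t * g t)
  W≡Σtg = trans (Σ-reflect n _) (Σ-cong n λ 1≤t t≤n →
    cong₂ (λ i x → ℕ→ℚ i * x) (ℕ.m∸[m∸n]≡n (ℕ.m≤n⇒m≤1+n t≤n)) (g-sym 1≤t t≤n))

  weights-add-up : ∀ {t} → 1 ≤ t → t ≤ n → ℕ→ℚ (suc n ∸ t) * g t + ℕ→ℚ t * g t ≡ ℕ→ℚ (suc n) * g t
  weights-add-up {t} _ t≤n = begin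
    ℕ→ℚ (suc n ∸ t) * g t + ℕ→ℚ t * g t   ≡⟨ *-distribʳ-+ (g t) (ℕ→ℚ (suc n ∸ t)) (ℕ→ℚ t) ⟨
    (ℕ→ℚ (suc n ∸ t) + ℕ→ℚ t) * g t       ≡⟨ cong (_* g t) (ℕ→ℚ-homo-+ (suc n ∸ t) t) ⟨
    ℕ→ℚ (suc n ∸ t ℕ.+ t) * g t           ≡⟨ cong (λ i → ℕ→ℚ i * g t) (ℕ.m∸n+n≡m (ℕ.m≤n⇒m≤1+n t≤n)) ⟩
    ℕ→ℚ (suc n) * g t                     ∎

bbSum : ℕ → ℚ
bbSum k = Σ (k ∸ 1) (λ t → ℕ→ℚ (t ℕ.* (k ∸ t)) * b t * b (k ∸ t))

bcSum : ℕ → (ℕ → ℚ) → ℚ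
bcSum k C = Σ (k ∸ 1) (λ t → ℕ→ℚ (t ℕ.* (3 ℕ.* k ∸ 3 ℕ.* t ∸ 1)) * b t * C (k ∸ t))

private
  cong₄ : ∀ {A : Set} (f : ℚ → ℚ → ℚ → ℚ → A) {w w′ x x′ y y′ z z′} →
          w ≡ w′ → x ≡ x′ → y ≡ y′ → z ≡ z′ → f w x y z ≡ f w′ x′ y′ z′
  cong₄ f refl refl refl refl = refl

  ≡ᵇ-refl : ∀ n → (n ≡ᵇ n) ≡ true
  ≡ᵇ-refl n = Equivalence.to T-≡ (ℕ.≡⇒≡ᵇ n n refl)

  <⇒≡ᵇ-false : ∀ {m n} → m < n → (m ≡ᵇ n) ≡ false
  <⇒≡ᵇ-false {m} {n} m<n = ¬-not λ m≡ᵇn → ℕ.<⇒≢ m<n (ℕ.≡ᵇ⇒≡ m n (Equivalence.from T-≡ m≡ᵇn))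

bc-stable : ∀ j {i} → i ≤ suc j → proj₁ (bc j) i ≡ b i × proj₂ (bc j) i ≡ c i
bc-stable zero    {zero}          _     = refl , refl
bc-stable zero    {suc zero}      _     = refl , refl
bc-stable zero    {suc (suc _)}   (s≤s ())
bc-stable (suc j) {i}             i≤2+j with ℕ.m≤n⇒m<n∨m≡n i≤2+j
... | inj₂ refl  = refl , refl
... | inj₁ i<2+j rewrite <⇒≡ᵇ-false i<2+j = bc-stable j (ℕ.≤-pred i<2+j)

b-unfold : ∀ {k} → 1 ≤ k →
           b (suc k) ≡ (ℕ→ℚ (3 ℕ.* k ℕ.* suc k) * b k + 3 * bbSum k) * (+ 1 / (2 ℕ.* suc k))
b-unfold {k@(suc j)} _ rewrite ≡ᵇ-refl j =
  cong₂ (λ x y → (ℕ→ℚ (3 ℕ.* k ℕ.* suc k) * x + 3 * y) * (+ 1 / (2 ℕ.* suc k)))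
    (proj₁ (bc-stable j ℕ.≤-refl))
    (Σ-cong j λ {t} _ t≤j → cong₂ (λ x y → ℕ→ℚ (t ℕ.* (k ∸ t)) * x * y)
       (proj₁ (bc-stable j (ℕ.m≤n⇒m≤1+n t≤j))) (proj₁ (bc-stable j (ℕ.m∸n≤m k t))))

c-unfold : ∀ {k} → 1 ≤ k →
           c (suc k) ≡ ( ℕ→ℚ (8 ℕ.* suc k) * b (suc k) + ℕ→ℚ (3 ℕ.* k) * b k
                       + ℕ→ℚ ((2 ℕ.+ 3 ℕ.* k) ℕ.* (3 ℕ.* k ∸ 1)) * c k + 6 * bcSum k c )
                       * (+ 1 / (2 ℕ.* (2 ℕ.+ 3 ℕ.* k)))
c-unfold {k@(suc j)} _ rewrite ≡ᵇ-refl j =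
  -- the rewrite has also unfolded b (suc k) to the very term used by the recurrence for c
  cong₄ (λ w x y z → (ℕ→ℚ (8 ℕ.* suc k) * w + ℕ→ℚ (3 ℕ.* k) * x
                       + ℕ→ℚ ((2 ℕ.+ 3 ℕ.* k) ℕ.* (3 ℕ.* k ∸ 1)) * y + 6 * z)
                      * (+ 1 / (2 ℕ.* (2 ℕ.+ 3 ℕ.* k))))
    refl
    (proj₁ (bc-stable j ℕ.≤-refl))
    (proj₂ (bc-stable j ℕ.≤-refl))
    (Σ-cong j λ {t} _ t≤j → cong₂ (λ x y → ℕ→ℚ (t ℕ.* (3 ℕ.* k ∸ 3 ℕ.* t ∸ 1)) * x * y)
       (proj₁ (bc-stable j (ℕ.m≤n⇒m≤1+n t≤j))) (proj₂ (bc-stable j (ℕ.m∸n≤m k t))))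

b-recurrence : ∀ {k} → 1 ≤ k →
  2 * (1 + ℕ→ℚ k) * b (suc k) ≡ 3 * ℕ→ℚ k * (1 + ℕ→ℚ k) * b k + 3 * bbSum k
b-recurrence {k} 1≤k = begin
  2 * (1 + K) * b (suc k)                                     ≡⟨ cong (_* b (suc k)) 2[1+k] ⟨
  ℕ→ℚ (2 ℕ.* suc k) * b (suc k)                               ≡⟨ cong (_*_ (ℕ→ℚ (2 ℕ.* suc k))) (b-unfold 1≤k) ⟩
  ℕ→ℚ (2 ℕ.* suc k) * (rhs * (+ 1 / (2 ℕ.* suc k)))          ≡⟨ n*[x*1/n]≡x (2 ℕ.* suc k) rhs ⟩
  ℕ→ℚ (3 ℕ.* k ℕ.* suc k) * b k + 3 * bbSum k                 ≡⟨ cong (λ x → x * b k + 3 * bbSum k) 3k[1+k] ⟩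
  3 * K * (1 + K) * b k + 3 * bbSum k                         ∎
  where
  open ≡-Reasoning
  K rhs : ℚ
  K   = ℕ→ℚ k
  rhs = ℕ→ℚ (3 ℕ.* k ℕ.* suc k) * b k + 3 * bbSum k

  2[1+k] : ℕ→ℚ (2 ℕ.* suc k) ≡ 2 * (1 + K)
  2[1+k] = trans (ℕ→ℚ-homo-* 2 (suc k)) (cong (_*_ 2) (ℕ→ℚ-suc k))

  3k[1+k] : ℕ→ℚ (3 ℕ.* k ℕ.* suc k) ≡ 3 * K * (1 + K)
  3k[1+k] = trans (ℕ→ℚ-homo-* (3 ℕ.* k) (suc k)) (cong₂ _*_ (ℕ→ℚ-homo-* 3 k) (ℕ→ℚ-suc k))

c-recurrence : ∀ {k} → 1 ≤ k →
  2 * (2 + 3 * ℕ→ℚ k) * c (suc k) ≡ 8 * (1 + ℕ→ℚ k) * b (suc k) + 3 * ℕ→ℚ k * b k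
                                    + (2 + 3 * ℕ→ℚ k) * (3 * ℕ→ℚ k - 1) * c k + 6 * bcSum k c
c-recurrence {k} 1≤k = begin
  2 * (2 + 3 * K) * c (suc k)                                 ≡⟨ cong (_* c (suc k)) 2[2+3k] ⟨
  ℕ→ℚ (2 ℕ.* (2 ℕ.+ 3 ℕ.* k)) * c (suc k)                     ≡⟨ cong (_*_ (ℕ→ℚ (2 ℕ.* (2 ℕ.+ 3 ℕ.* k)))) (c-unfold 1≤k) ⟩
  ℕ→ℚ (2 ℕ.* (2 ℕ.+ 3 ℕ.* k)) * (rhs * (+ 1 / (2 ℕ.* (2 ℕ.+ 3 ℕ.* k))))
                                                              ≡⟨ n*[x*1/n]≡x (2 ℕ.* (2 ℕ.+ 3 ℕ.* k)) rhs ⟩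
  rhs                                                         ≡⟨ cong₂ (λ x z → x + z * c k + 6 * bcSum k c)
                                                                   (cong₂ (λ x y → x * b (suc k) + y * b k) 8[1+k] (ℕ→ℚ-homo-* 3 k))
                                                                   [2+3k][3k-1] ⟩
  8 * (1 + K) * b (suc k) + 3 * K * b k + (2 + 3 * K) * (3 * K - 1) * c k + 6 * bcSum k c ∎
  where
  open ≡-Reasoning
  K rhs : ℚ
  K   = ℕ→ℚ k
  rhs = ℕ→ℚ (8 ℕ.* suc k) * b (suc k) + ℕ→ℚ (3 ℕ.* k) * b k
      + ℕ→ℚ ((2 ℕ.+ 3 ℕ.* k) ℕ.* (3 ℕ.* k ∸ 1)) * c k + 6 * bcSum k c

  2+3k : ℕ→ℚ (2 ℕ.+ 3 ℕ.* k) ≡ 2 + 3 * K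
  2+3k = trans (ℕ→ℚ-homo-+ 2 (3 ℕ.* k)) (cong (_+_ 2) (ℕ→ℚ-homo-* 3 k))

  2[2+3k] : ℕ→ℚ (2 ℕ.* (2 ℕ.+ 3 ℕ.* k)) ≡ 2 * (2 + 3 * K)
  2[2+3k] = trans (ℕ→ℚ-homo-* 2 (2 ℕ.+ 3 ℕ.* k)) (cong (_*_ 2) 2+3k)

  8[1+k] : ℕ→ℚ (8 ℕ.* suc k) ≡ 8 * (1 + K)
  8[1+k] = trans (ℕ→ℚ-homo-* 8 (suc k)) (cong (_*_ 8) (ℕ→ℚ-suc k))

  [2+3k][3k-1] : ℕ→ℚ ((2 ℕ.+ 3 ℕ.* k) ℕ.* (3 ℕ.* k ∸ 1)) ≡ (2 + 3 * K) * (3 * K - 1)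
  [2+3k][3k-1] = trans (ℕ→ℚ-homo-* (2 ℕ.+ 3 ℕ.* k) (3 ℕ.* k ∸ 1)) (cong₂ _*_ 2+3k
    (trans (ℕ→ℚ-homo-∸ (ℕ.≤-trans 1≤k (ℕ.m≤n*m k 3))) (cong (_- 1) (ℕ→ℚ-homo-* 3 k))))

bbSum-nonNeg : ∀ k → (∀ {i} → i ≤ k → 0ℚ ≤ℚ b i) → 0ℚ ≤ℚ bbSum k
bbSum-nonNeg k 0≤b = Σ-nonNeg (k ∸ 1) λ {t} _ t≤k-1 →
  *-nonNeg (*-nonNeg (ℕ→ℚ-nonNeg (t ℕ.* (k ∸ t))) (0≤b (ℕ.≤-trans t≤k-1 (ℕ.m∸n≤m k 1))))
           (0≤b (ℕ.m∸n≤m k t))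

b-nonNeg : ∀ k → 0ℚ ≤ℚ b k
b-nonNeg = <-rec (λ k → 0ℚ ≤ℚ b k) λ where
  zero          _  → nonNegative⁻¹ _
  (suc zero)    _  → nonNegative⁻¹ _
  (suc k@(suc j)) ih → subst (0ℚ ≤ℚ_) (sym (b-unfold {k} (s≤s z≤n)))
    (*-nonNeg (+-nonNeg (*-nonNeg (ℕ→ℚ-nonNeg (3 ℕ.* k ℕ.* suc k)) (ih ℕ.≤-refl))
                        (*-nonNeg (ℕ→ℚ-nonNeg 3) (bbSum-nonNeg k λ i≤k → ih (s≤s i≤k))))
              (nonNegative⁻¹ _ {{normalize-nonNeg 1 (2 ℕ.* suc k)}}))

bcSum-mono-≤ : ∀ k {C D : ℕ → ℚ} → (∀ {i} → 1 ≤ i → i < k → C i ≤ℚ D i) → bcSum k C ≤ℚ bcSum k D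
bcSum-mono-≤ zero          C≤D = ≤-refl
bcSum-mono-≤ k@(suc j) C≤D = Σ-mono-≤ j λ {t} 1≤t t≤j →
  *-monoˡ-≤ (*-nonNeg (ℕ→ℚ-nonNeg (t ℕ.* (3 ℕ.* k ∸ 3 ℕ.* t ∸ 1))) (b-nonNeg t))
            (C≤D (ℕ.m<n⇒0<n∸m (s≤s t≤j)) (ℕ.∸-monoʳ-< 1≤t (ℕ.m≤n⇒m≤1+n t≤j)))

bcSum-*ˡ : ∀ k a (C : ℕ → ℚ) → bcSum k (λ i → a * C i) ≡ a * bcSum k C
bcSum-*ˡ k a C = trans (Σ-cong (k ∸ 1) λ {t} _ _ → x*y*[a*z]≡a*[x*y*z] (ℕ→ℚ (t ℕ.* (3 ℕ.* k ∸ 3 ℕ.* t ∸ 1))) (b t) a (C (k ∸ t)))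
                       (Σ-*ˡ (k ∸ 1) a _)
  where
  x*y*[a*z]≡a*[x*y*z] : ∀ x y a z → x * y * (a * z) ≡ a * (x * y * z)
  x*y*[a*z]≡a*[x*y*z] = solve-∀ ℚ-ring

bcSum-kb : ∀ k → 2 * bcSum k (λ i → ℕ→ℚ i * b i) ≡ (3 * ℕ→ℚ k - 2) * bbSum k
bcSum-kb zero        = refl
bcSum-kb k@(suc j) = begin
  2 * bcSum k (λ i → ℕ→ℚ i * b i)                   ≡⟨ cong (_*_ 2) (Σ-cong j summand) ⟩
  2 * Σ j (λ t → 3 * (ℕ→ℚ (k ∸ t) * g t) + - 1 * g t) ≡⟨ cong (_*_ 2) (Σ-linear j 3 (- 1) _ g) ⟩
  2 * (3 * W + - 1 * S)                               ≡⟨ regroup W S ⟩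
  3 * (2 * W) - 2 * S                                 ≡⟨ cong (λ x → 3 * x - 2 * S) (Σ-symmetric-weight j g g-symmetric) ⟩
  3 * (K * S) - 2 * S                                 ≡⟨ factor K S ⟩
  (3 * K - 2) * S                                     ∎
  where
  open ≡-Reasoning
  K S W : ℚ
  g : ℕ → ℚ
  g t = ℕ→ℚ (t ℕ.* (k ∸ t)) * b t * b (k ∸ t)
  K = ℕ→ℚ k
  S = Σ j g
  W = Σ j (λ t → ℕ→ℚ (k ∸ t) * g t)

  regroup : ∀ W S → 2 * (3 * W + - 1 * S) ≡ 3 * (2 * W) - 2 * S
  regroup = solve-∀ ℚ-ring

  factor : ∀ K S → 3 * (K * S) - 2 * S ≡ (3 * K - 2) * S
  factor = solve-∀ ℚ-ring

  g-symmetric : ∀ {t} → 1 ≤ t → t ≤ j → g (k ∸ t) ≡ g t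
  g-symmetric {t} _ t≤j rewrite ℕ.m∸[m∸n]≡n (ℕ.m≤n⇒m≤1+n t≤j) =
    trans (cong (λ n → ℕ→ℚ n * b (k ∸ t) * b t) (ℕ.*-comm (k ∸ t) t)) (x*y*z≡x*z*y (ℕ→ℚ (t ℕ.* (k ∸ t))) (b (k ∸ t)) (b t))
    where
    x*y*z≡x*z*y : ∀ x y z → x * y * z ≡ x * z * y
    x*y*z≡x*z*y = solve-∀ ℚ-ring

  summand : ∀ {t} → 1 ≤ t → t ≤ j →
            ℕ→ℚ (t ℕ.* (3 ℕ.* k ∸ 3 ℕ.* t ∸ 1)) * b t * (ℕ→ℚ (k ∸ t) * b (k ∸ t))
            ≡ 3 * (ℕ→ℚ (k ∸ t) * g t) + - 1 * g t
  summand {t} _ t≤j = begin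
    ℕ→ℚ (t ℕ.* (3 ℕ.* k ∸ 3 ℕ.* t ∸ 1)) * b t * (D * b (k ∸ t))
      ≡⟨ cong (λ x → x * b t * (D * b (k ∸ t))) t[3[k-t]-1] ⟩
    ℕ→ℚ t * (3 * D - 1) * b t * (D * b (k ∸ t))
      ≡⟨ expand (ℕ→ℚ t) D (b t) (b (k ∸ t)) ⟩
    3 * (D * (ℕ→ℚ t * D * b t * b (k ∸ t))) + - 1 * (ℕ→ℚ t * D * b t * b (k ∸ t))
      ≡⟨ cong (λ x → 3 * (D * (x * b t * b (k ∸ t))) + - 1 * (x * b t * b (k ∸ t))) (ℕ→ℚ-homo-* t (k ∸ t)) ⟨
    3 * (D * g t) + - 1 * g t ∎
    where
    D : ℚ
    D = ℕ→ℚ (k ∸ t)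

    expand : ∀ T D x y → T * (3 * D - 1) * x * (D * y) ≡ 3 * (D * (T * D * x * y)) + - 1 * (T * D * x * y)
    expand = solve-∀ ℚ-ring

    1≤3[k-t] : 1 ≤ 3 ℕ.* (k ∸ t)
    1≤3[k-t] = ℕ.≤-trans (ℕ.m<n⇒0<n∸m (s≤s t≤j)) (ℕ.m≤n*m (k ∸ t) 3)

    t[3[k-t]-1] : ℕ→ℚ (t ℕ.* (3 ℕ.* k ∸ 3 ℕ.* t ∸ 1)) ≡ ℕ→ℚ t * (3 * D - 1)
    t[3[k-t]-1] = begin
      ℕ→ℚ (t ℕ.* (3 ℕ.* k ∸ 3 ℕ.* t ∸ 1))   ≡⟨ cong (λ n → ℕ→ℚ (t ℕ.* (n ∸ 1))) (ℕ.*-distribˡ-∸ 3 k t) ⟨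
      ℕ→ℚ (t ℕ.* (3 ℕ.* (k ∸ t) ∸ 1))       ≡⟨ ℕ→ℚ-homo-* t _ ⟩
      ℕ→ℚ t * ℕ→ℚ (3 ℕ.* (k ∸ t) ∸ 1)       ≡⟨ cong (_*_ (ℕ→ℚ t)) (ℕ→ℚ-homo-∸ 1≤3[k-t]) ⟩
      ℕ→ℚ t * (ℕ→ℚ (3 ℕ.* (k ∸ t)) - 1)     ≡⟨ cong (λ x → ℕ→ℚ t * (x - 1)) (ℕ→ℚ-homo-* 3 (k ∸ t)) ⟩
      ℕ→ℚ t * (3 * D - 1)                   ∎

-- K = k, β = b_k, γ = c_k, S = bbSum k, U = bcSum k c, b′ = b_{k+1}, c′ = c_{k+1}.
module WrightStep {K β γ S U b′ c′ : ℚ} (1≤K : 1 ≤ℚ K) (0≤β : 0ℚ ≤ℚ β) (0≤S : 0ℚ ≤ℚ S)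
  (b-rec : 2 * (1 + K) * b′ ≡ 3 * K * (1 + K) * β + 3 * S)
  (c-rec : 2 * (2 + 3 * K) * c′ ≡ 8 * (1 + K) * b′ + 3 * K * β + (2 + 3 * K) * (3 * K - 1) * γ + 6 * U)
  where

  private
    P A : ℚ
    P = 3 * K * (1 + K) * β + 3 * S
    A = (2 + 3 * K) * (3 * K - 1)

    0≤K : 0ℚ ≤ℚ K
    0≤K = ≤-trans (nonNegative⁻¹ 1) 1≤K

    0≤A : 0ℚ ≤ℚ A
    0≤A = *-nonNeg (+-nonNeg (nonNegative⁻¹ 2) (*-nonNeg (nonNegative⁻¹ 3) 0≤K))
                   (subst (0ℚ ≤ℚ_) (3[K-1]+2≡3K-1 K)
                     (+-nonNeg (*-nonNeg (nonNegative⁻¹ 3) (+-monoˡ-≤ (- 1) 1≤K)) (nonNegative⁻¹ 2)))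
      where
      3[K-1]+2≡3K-1 : ∀ K → 3 * (K - 1) + 2 ≡ 3 * K - 1
      3[K-1]+2≡3K-1 = solve-∀ ℚ-ring

    0<2[2+3K] : 0ℚ <ℚ 2 * (2 + 3 * K)
    0<2[2+3K] = subst (0ℚ <ℚ_) (4+6K≡2[2+3K] K)
                  (+-mono-<-≤ (positive⁻¹ 4) (*-nonNeg (nonNegative⁻¹ 6) 0≤K))
      where
      4+6K≡2[2+3K] : ∀ K → 4 + 6 * K ≡ 2 * (2 + 3 * K)
      4+6K≡2[2+3K] = solve-∀ ℚ-ring

    scaled-b-rec : 2 * (2 + 3 * K) * ((1 + K) * b′) ≡ (2 + 3 * K) * P
    scaled-b-rec = trans (rearrange K b′) (cong (_*_ (2 + 3 * K)) b-rec)
      where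
      rearrange : ∀ K b′ → 2 * (2 + 3 * K) * ((1 + K) * b′) ≡ (2 + 3 * K) * (2 * (1 + K) * b′)
      rearrange = solve-∀ ℚ-ring

    c-rec′ : 2 * (2 + 3 * K) * c′ ≡ 4 * P + 3 * K * β + A * γ + 3 * (2 * U)
    c-rec′ = begin
      2 * (2 + 3 * K) * c′                                   ≡⟨ c-rec ⟩
      8 * (1 + K) * b′ + 3 * K * β + A * γ + 6 * U            ≡⟨ cong₂ (λ x y → x + 3 * K * β + A * γ + y)
                                                                  (trans (8*x*y≡4*[2*x*y] (1 + K) b′) (cong (_*_ 4) b-rec))
                                                                  (6*x≡3*[2*x] U) ⟩
      4 * P + 3 * K * β + A * γ + 3 * (2 * U)                 ∎
      where
      open ≡-Reasoning
      8*x*y≡4*[2*x*y] : ∀ x y → 8 * x * y ≡ 4 * (2 * x * y)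
      8*x*y≡4*[2*x*y] = solve-∀ ℚ-ring
      6*x≡3*[2*x] : ∀ x → 6 * x ≡ 3 * (2 * x)
      6*x≡3*[2*x] = solve-∀ ℚ-ring

  lower : K * β ≤ℚ γ → (3 * K - 2) * S ≤ℚ 2 * U → (1 + K) * b′ ≤ℚ c′
  lower Kβ≤γ [3K-2]S≤2U = *-cancelˡ-≤-pos (2 * (2 + 3 * K)) {{positive 0<2[2+3K]}} (begin
    2 * (2 + 3 * K) * ((1 + K) * b′)                                ≡⟨ scaled-b-rec ⟩
    (2 + 3 * K) * P                                                 ≤⟨ p≤p+q (*-nonNeg (*-nonNeg (nonNegative⁻¹ 7) 0≤K) 0≤β) ⟩
    (2 + 3 * K) * P + 7 * K * β                                     ≡⟨ identity K β S ⟩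
    4 * P + 3 * K * β + A * (K * β) + 3 * ((3 * K - 2) * S)        ≤⟨ +-mono-≤ (+-monoʳ-≤ (4 * P + 3 * K * β) (*-monoˡ-≤ 0≤A Kβ≤γ))
                                                                                (*-monoˡ-≤ (nonNegative⁻¹ 3) [3K-2]S≤2U) ⟩
    4 * P + 3 * K * β + A * γ + 3 * (2 * U)                         ≡⟨ c-rec′ ⟨
    2 * (2 + 3 * K) * c′                                            ∎)
    where
    open ≤-Reasoning
    identity : ∀ K β S → (2 + 3 * K) * (3 * K * (1 + K) * β + 3 * S) + 7 * K * β
                         ≡ 4 * (3 * K * (1 + K) * β + 3 * S) + 3 * K * β
                           + (2 + 3 * K) * (3 * K - 1) * (K * β) + 3 * ((3 * K - 2) * S)
    identity = solve-∀ ℚ-ring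

  upper : γ ≤ℚ + 19 / 5 * (K * β) → 2 * U ≤ℚ + 19 / 5 * ((3 * K - 2) * S) → c′ ≤ℚ + 19 / 5 * ((1 + K) * b′)
  upper γ≤19/5Kβ 2U≤19/5[3K-2]S = *-cancelˡ-≤-pos (2 * (2 + 3 * K)) {{positive 0<2[2+3K]}} (begin
    2 * (2 + 3 * K) * c′                                            ≡⟨ c-rec′ ⟩
    4 * P + 3 * K * β + A * γ + 3 * (2 * U)                         ≤⟨ +-mono-≤ (+-monoʳ-≤ (4 * P + 3 * K * β) (*-monoˡ-≤ 0≤A γ≤19/5Kβ))
                                                                                (*-monoˡ-≤ (nonNegative⁻¹ 3) 2U≤19/5[3K-2]S) ⟩
    4 * P + 3 * K * β + A * (+ 19 / 5 * (K * β)) + 3 * (+ 19 / 5 * ((3 * K - 2) * S))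
                                                                    ≤⟨ p≤p+q slack-nonNeg ⟩
    4 * P + 3 * K * β + A * (+ 19 / 5 * (K * β)) + 3 * (+ 19 / 5 * ((3 * K - 2) * S)) + slack
                                                                    ≡⟨ identity K β S ⟩
    + 19 / 5 * ((2 + 3 * K) * P)                                    ≡⟨ cong (_*_ (+ 19 / 5)) scaled-b-rec ⟨
    + 19 / 5 * (2 * (2 + 3 * K) * ((1 + K) * b′))                   ≡⟨ *-leftComm (+ 19 / 5) (2 * (2 + 3 * K)) ((1 + K) * b′) ⟩
    2 * (2 + 3 * K) * (+ 19 / 5 * ((1 + K) * b′))                   ∎)
    where
    open ≤-Reasoning
    slack : ℚ
    slack = + 1 / 5 * ((168 * K + 77) * (K * β) + 168 * S)

    slack-nonNeg : 0ℚ ≤ℚ slack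
    slack-nonNeg = *-nonNeg (nonNegative⁻¹ _)
      (+-nonNeg (*-nonNeg (+-nonNeg (*-nonNeg (nonNegative⁻¹ 168) 0≤K) (nonNegative⁻¹ 77)) (*-nonNeg 0≤K 0≤β))
                (*-nonNeg (nonNegative⁻¹ 168) 0≤S))

    identity : ∀ K β S → 4 * (3 * K * (1 + K) * β + 3 * S) + 3 * K * β
                         + (2 + 3 * K) * (3 * K - 1) * (+ 19 / 5 * (K * β)) + 3 * (+ 19 / 5 * ((3 * K - 2) * S))
                         + + 1 / 5 * ((168 * K + 77) * (K * β) + 168 * S)
                         ≡ + 19 / 5 * ((2 + 3 * K) * (3 * K * (1 + K) * β + 3 * S))
    identity = solve-∀ ℚ-ring

WrightBounds : ℚ → ℚ → ℚ → Set
WrightBounds K β γ = K * β ≤ℚ γ × γ ≤ℚ + 19 / 5 * (K * β)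

wright-bounds-step : ∀ {k} → 1 ≤ k → (∀ {i} → 1 ≤ i → i ≤ k → WrightBounds (ℕ→ℚ i) (b i) (c i)) →
                     WrightBounds (ℕ→ℚ (suc k)) (b (suc k)) (c (suc k))
wright-bounds-step {k} 1≤k ih rewrite ℕ→ℚ-suc k =
    lower (proj₁ (ih 1≤k ℕ.≤-refl)) 2bcSum-lower
  , upper (proj₂ (ih 1≤k ℕ.≤-refl)) 2bcSum-upper
  where
  open WrightStep {U = bcSum k c} (ℕ→ℚ-mono-≤ 1≤k) (b-nonNeg k) (bbSum-nonNeg k λ {i} _ → b-nonNeg i)
                  (b-recurrence 1≤k) (c-recurrence 1≤k)
  open ≤-Reasoning

  kb : ℕ → ℚ
  kb i = ℕ→ℚ i * b i

  2bcSum-lower : (3 * ℕ→ℚ k - 2) * bbSum k ≤ℚ 2 * bcSum k c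
  2bcSum-lower = begin
    (3 * ℕ→ℚ k - 2) * bbSum k            ≡⟨ bcSum-kb k ⟨
    2 * bcSum k kb                        ≤⟨ *-monoˡ-≤ (nonNegative⁻¹ 2) (bcSum-mono-≤ k λ 1≤i i<k → proj₁ (ih 1≤i (ℕ.<⇒≤ i<k))) ⟩
    2 * bcSum k c                         ∎

  2bcSum-upper : 2 * bcSum k c ≤ℚ + 19 / 5 * ((3 * ℕ→ℚ k - 2) * bbSum k)
  2bcSum-upper = begin
    2 * bcSum k c                                  ≤⟨ *-monoˡ-≤ (nonNegative⁻¹ 2) (bcSum-mono-≤ k λ 1≤i i<k → proj₂ (ih 1≤i (ℕ.<⇒≤ i<k))) ⟩
    2 * bcSum k (λ i → + 19 / 5 * kb i)            ≡⟨ cong (_*_ 2) (bcSum-*ˡ k (+ 19 / 5) kb) ⟩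
    2 * (+ 19 / 5 * bcSum k kb)                    ≡⟨ *-leftComm 2 (+ 19 / 5) (bcSum k kb) ⟩
    + 19 / 5 * (2 * bcSum k kb)                    ≡⟨ cong (_*_ (+ 19 / 5)) (bcSum-kb k) ⟩
    + 19 / 5 * ((3 * ℕ→ℚ k - 2) * bbSum k)         ∎

wright-bounds : ∀ {k} → 1 ≤ k → WrightBounds (ℕ→ℚ k) (b k) (c k)
wright-bounds {k} = <-rec (λ k → 1 ≤ k → WrightBounds (ℕ→ℚ k) (b k) (c k)) (λ where
    zero          _  ()
    (suc zero)    _  _ → ≤ᵇ⇒≤ _ , ≤ᵇ⇒≤ _
    (suc (suc j)) ih _ → wright-bounds-step (s≤s z≤n) λ 1≤i i≤1+j → ih (s≤s i≤1+j) 1≤i)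
  k

b-growth : ∀ {k} → 1 ≤ k → 3 * (ℕ→ℚ k * b k) ≤ℚ 2 * (ℕ→ℚ (suc k) * b (suc k))
b-growth {k} 1≤k = begin
  3 * (K * b k)                                          ≤⟨ p≤p+q (+-nonNeg (*-nonNeg (nonNegative⁻¹ 3) (*-nonNeg 0≤K (*-nonNeg 0≤K (b-nonNeg k))))
                                                                            (*-nonNeg (nonNegative⁻¹ 3) (bbSum-nonNeg k λ {i} _ → b-nonNeg i))) ⟩
  3 * (K * b k) + (3 * (K * (K * b k)) + 3 * bbSum k)    ≡⟨ identity K (b k) (bbSum k) ⟩
  3 * K * (1 + K) * b k + 3 * bbSum k                    ≡⟨ b-recurrence 1≤k ⟨
  2 * (1 + K) * b (suc k)                                ≡⟨ *-assoc 2 (1 + K) (b (suc k)) ⟩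
  2 * ((1 + K) * b (suc k))                              ≡⟨ cong (λ x → 2 * (x * b (suc k))) (ℕ→ℚ-suc k) ⟨
  2 * (ℕ→ℚ (suc k) * b (suc k))                          ∎
  where
  open ≤-Reasoning
  K : ℚ
  K = ℕ→ℚ k

  0≤K : 0ℚ ≤ℚ K
  0≤K = ℕ→ℚ-nonNeg k

  identity : ∀ K β S → 3 * (K * β) + (3 * (K * (K * β)) + 3 * S) ≡ 3 * K * (1 + K) * β + 3 * S
  identity = solve-∀ ℚ-ring

ξ-constant : ∀ r d-1 → + (19 ℕ.+ 6 ℕ.* r) / suc d-1 ≡ (19 + 6 * ℕ→ℚ r) * (+ 1 / suc d-1)
ξ-constant r d-1 = trans (n/d≡n*[1/d] (19 ℕ.+ 6 ℕ.* r) d-1)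
  (cong (_* (+ 1 / suc d-1)) (trans (ℕ→ℚ-homo-+ 19 (6 ℕ.* r)) (cong (_+_ 19) (ℕ→ℚ-homo-* 6 r))))

cξ-bounds-at-1 : ∀ r → ℕ→ℚ 1 * b 1 ≤ℚ cξ r 1 × cξ r 1 ≤ℚ + (19 ℕ.+ 6 ℕ.* r) / 5 * ℕ→ℚ 1 * b 1
cξ-bounds-at-1 r = lower , upper
  where
  open ≤-Reasoning
  n : ℕ
  n = 19 ℕ.+ 6 ℕ.* r

  lower : + 5 / 24 ≤ℚ + n / 24
  lower = begin
    + 5 / 24                                 ≡⟨ n/d≡n*[1/d] 5 23 ⟩
    ℕ→ℚ 5 * (+ 1 / 24)                       ≤⟨ *-monoʳ-≤-nonNeg (+ 1 / 24) (ℕ→ℚ-mono-≤ (ℕ.m≤m+n 5 (14 ℕ.+ 6 ℕ.* r))) ⟩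
    ℕ→ℚ n * (+ 1 / 24)                       ≡⟨ n/d≡n*[1/d] n 23 ⟨
    + n / 24                                 ∎

  upper : + n / 24 ≤ℚ + n / 5 * 1 * (+ 5 / 24)
  upper = begin
    + n / 24                                 ≡⟨ n/d≡n*[1/d] n 23 ⟩
    ℕ→ℚ n * (+ 1 / 24)                       ≡⟨ constants (ℕ→ℚ n) ⟩
    ℕ→ℚ n * (+ 1 / 5) * 1 * (+ 5 / 24)       ≡⟨ cong (λ x → x * 1 * (+ 5 / 24)) (n/d≡n*[1/d] n 4) ⟨
    + n / 5 * 1 * (+ 5 / 24)                 ∎
    where
    constants : ∀ x → x * (+ 1 / 24) ≡ x * (+ 1 / 5) * 1 * (+ 5 / 24)
    constants = solve-∀ ℚ-ring

ξ-term-growth : ∀ r {k} → 1 ≤ k →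
                + 3 / 2 * ℕ→ℚ r * ℕ→ℚ k * b k ≤ℚ + 6 / 5 * ℕ→ℚ r * (ℕ→ℚ (suc k) * b (suc k))
ξ-term-growth r {k} 1≤k = begin
  + 3 / 2 * R * ℕ→ℚ k * b k                                ≡⟨ regroup R (ℕ→ℚ k) (b k) ⟩
  + 1 / 2 * R * (3 * (ℕ→ℚ k * b k))                        ≤⟨ *-monoˡ-≤ 0≤R/2 (b-growth {k} 1≤k) ⟩
  + 1 / 2 * R * (2 * K′b′)                                  ≤⟨ p≤p+q (*-nonNeg (*-nonNeg (nonNegative⁻¹ _) 0≤R) 0≤K′b′) ⟩
  + 1 / 2 * R * (2 * K′b′) + + 1 / 5 * R * K′b′             ≡⟨ collect R K′b′ ⟩
  + 6 / 5 * R * K′b′                                        ∎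
  where
  open ≤-Reasoning
  R K′b′ : ℚ
  R    = ℕ→ℚ r
  K′b′ = ℕ→ℚ (suc k) * b (suc k)

  0≤R : 0ℚ ≤ℚ R
  0≤R = ℕ→ℚ-nonNeg r

  0≤R/2 : 0ℚ ≤ℚ + 1 / 2 * R
  0≤R/2 = *-nonNeg (nonNegative⁻¹ _) 0≤R

  0≤K′b′ : 0ℚ ≤ℚ K′b′
  0≤K′b′ = *-nonNeg (ℕ→ℚ-nonNeg (suc k)) (b-nonNeg (suc k))

  regroup : ∀ R K β → + 3 / 2 * R * K * β ≡ + 1 / 2 * R * (3 * (K * β))
  regroup = solve-∀ ℚ-ring

  collect : ∀ R x → + 1 / 2 * R * (2 * x) + + 1 / 5 * R * x ≡ + 6 / 5 * R * x
  collect = solve-∀ ℚ-ring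

lemma22 : (r k : ℕ) → 1 ≤ k →
    (ℕ→ℚ k * b k ≤ℚ cξ r k) × (cξ r k ≤ℚ (+ (19 Data.Nat.+ 6 Data.Nat.* r) / 5) * ℕ→ℚ k * b k)
lemma22 r zero ()
lemma22 r (suc zero) _ = cξ-bounds-at-1 r
lemma22 r (suc k@(suc _)) _ = ≤-trans (proj₁ bounds) (p≤p+q ξ-term-nonNeg) , (begin
  c (suc k) + ξ-term                                 ≤⟨ +-mono-≤ (proj₂ bounds) (ξ-term-growth r {k} (s≤s z≤n)) ⟩
  + 19 / 5 * K′b′ + + 6 / 5 * R * K′b′               ≡⟨ collect R (ℕ→ℚ (suc k)) (b (suc k)) ⟩
  (19 + 6 * R) * (+ 1 / 5) * ℕ→ℚ (suc k) * b (suc k) ≡⟨ cong (λ x → x * ℕ→ℚ (suc k) * b (suc k)) (ξ-constant r 4) ⟨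
  + (19 ℕ.+ 6 ℕ.* r) / 5 * ℕ→ℚ (suc k) * b (suc k)  ∎)
  where
  open ≤-Reasoning
  R ξ-term K′b′ : ℚ
  R      = ℕ→ℚ r
  ξ-term = + 3 / 2 * R * ℕ→ℚ k * b k
  K′b′   = ℕ→ℚ (suc k) * b (suc k)

  bounds : WrightBounds (ℕ→ℚ (suc k)) (b (suc k)) (c (suc k))
  bounds = wright-bounds {suc k} (s≤s z≤n)

  ξ-term-nonNeg : 0ℚ ≤ℚ ξ-term
  ξ-term-nonNeg = *-nonNeg (*-nonNeg (*-nonNeg (nonNegative⁻¹ _) (ℕ→ℚ-nonNeg r)) (ℕ→ℚ-nonNeg k)) (b-nonNeg k)

  collect : ∀ R K′ b′ → + 19 / 5 * (K′ * b′) + + 6 / 5 * R * (K′ * b′) ≡ (19 + 6 * R) * (+ 1 / 5) * K′ * b′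
  collect = solve-∀ ℚ-ring
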